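{- For every integer $n\ge 4$ and every graph $G$, the neighbourhood corona $K_n\star G$ is Class $0$, i.e. $\pi(K_n\star G)=|V(K_n\star G)|$.
   Context: For a simple graph $X=(V,E)$, a configuration is a function $\phi:V\to\mathbb{N}\cup\{0\}$; its size is $\sum_{u\in V}\phi(u)$. A pebbling step from a vertex $u$ to a neighbour $v$ removes two pebbles from $u$ and adds one pebble to $v$. For a target $r$, $\phi$ is $r$-solvable if some sequence of pebbling steps places at least one pebble on $r$. $\pi(X,r)$ is the minimum positive integer $m$ such that every configuration of size $m$ is $r$-solvable, and $\pi(X)=\max_{r\in V}\pi(X,r)$. $X$ is Class $0$ if $\pi(X)=|V(X)|$. The neighbourhood corona $A\star B$ is obtained from one copy of $A$ and $|V(A)|$ copies of $B$ by joining every neighbour (in $A$) of the $i$-th vertex of $A$ to every vertex of the $i$-th copy of $B$. -}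

module Defs where

open import Data.Nat using (ℕ; suc; _+_; _*_; _∸_; _≤_; _<_)
open import Data.Fin using (Fin; splitAt; remQuot; _≟_)
open import Data.Bool using (Bool; true; false; not; _∧_; if_then_else_)
open import Data.List using (tabulate)
open import Data.Nat.ListAction using (sum)
open import Data.Sum using (inj₁; inj₂)
open import Data.Product using (Σ; ∃; _×_; _,_)
open import Relation.Nullary using (¬_; does)
open import Relation.Binary.PropositionalEquality using (_≡_)
open import Relation.Binary.Construct.Closure.ReflexiveTransitive using (Star)

record SimpleGraph : Set where
  field
    size   : ℕ
    adj    : Fin size → Fin size → Bool
    sym    : ∀ i j → adj i j ≡ adj j i
    irrefl : ∀ i → adj i i ≡ false

open SimpleGraph public

Adjacency : ℕ → Set
Adjacency N = Fin N → Fin N → Bool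

completeAdj : (n : ℕ) → Adjacency n
completeAdj n i j = not (does (i ≟ j))

-- Vertex set Fin (n + n * m): the first n vertices are the copy of A;
-- a vertex k of the second block, with remQuot m k = (i , b), is the
-- vertex b of the i-th copy of B.
coronaAdj : (n m : ℕ) → Adjacency n → Adjacency m → Adjacency (n + n * m)
coronaAdj n m a b x y with splitAt n x | splitAt n y
... | inj₁ i | inj₁ j = a i j
... | inj₁ j | inj₂ k with remQuot {n} m k
...   | (i , _) = a j i
coronaAdj n m a b x y | inj₂ k | inj₁ j with remQuot {n} m k
...   | (i , _) = a j i
coronaAdj n m a b x y | inj₂ k | inj₂ l with remQuot {n} m k | remQuot {n} m l
...   | (i , c) | (j , d) = does (i ≟ j) ∧ b c d

KnStar : (n : ℕ) → (G : SimpleGraph) → Adjacency (n + n * size G)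
KnStar n G = coronaAdj n (size G) (completeAdj n) (adj G)

Config : ℕ → Set
Config N = Fin N → ℕ

configSize : ∀ {N} → Config N → ℕ
configSize {N} φ = sum (tabulate φ)

move : ∀ {N} → Config N → Fin N → Fin N → Config N
move φ u v w =
  if does (w ≟ u) then φ w ∸ 2 else (if does (w ≟ v) then suc (φ w) else φ w)

data Step {N : ℕ} (a : Adjacency N) : Config N → Config N → Set where
  step : ∀ φ u v → a u v ≡ true → 2 ≤ φ u → Step a φ (move φ u v)

Reach : ∀ {N} → Adjacency N → Config N → Config N → Set
Reach a = Star (Step a)

Solvable : ∀ {N} → Adjacency N → Fin N → Config N → Set
Solvable a r φ = ∃ λ ψ → Reach a φ ψ × 1 ≤ ψ r

AllSolvable : ∀ {N} → Adjacency N → Fin N → ℕ → Set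
AllSolvable {N} a r m = ∀ (φ : Config N) → configSize φ ≡ m → Solvable a r φ

IsRootedPebblingNumber : ∀ {N} → Adjacency N → Fin N → ℕ → Set
IsRootedPebblingNumber a r p =
  1 ≤ p × AllSolvable a r p × (∀ k → 1 ≤ k → k < p → ¬ AllSolvable a r k)

IsPebblingNumber : ∀ {N} → Adjacency N → ℕ → Set
IsPebblingNumber {N} a p =
  (∀ (r : Fin N) → ∃ λ k → IsRootedPebblingNumber a r k × k ≤ p)
  × (∃ λ (r : Fin N) → IsRootedPebblingNumber a r p)

Class0 : ∀ {N} → Adjacency N → Set
Class0 {N} a = IsPebblingNumber a N

-- In K_n ⋆ G the i-th vertex of K_n is a hub: it is adjacent to every vertex outside
-- its part, the part consisting of itself and the i-th copy of G.  As n ≥ 4, any three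
-- vertices have a common neighbour among the hubs.  Let |V| pebbles be placed with
-- none on the target r.  Some vertex v holds two pebbles.  If another vertex does too,
-- a common hub of v, w and r collects one pebble from each and passes one to r.
-- Otherwise take two hubs z₁, z₂ adjacent to v and r: a pebble on one of them, or four
-- pebbles on v, again lets a hub collect two pebbles; failing that, v holds at most
-- three pebbles, r, z₁, z₂ hold none and every other vertex at most one, fewer than
-- |V| in total.  Conversely, no graph is solved by fewer than |V| pebbles: put at most
-- one pebble on each vertex other than the target, and no move is possible.

module Submission where

open import Defs hiding (sym)
open import Data.Nat using (ℕ; zero; suc; _+_; _*_; _∸_; _≤_; _<_; z≤n; s≤s; _≤?_; >-nonZero⁻¹)
open import Data.Nat.Properties
  using (+-mono-≤; ≤-trans; ≤-refl; ≤-reflexive; ≮⇒≥; n≤0⇒n≡0; <⇒≢; ∸-monoˡ-≤; +-commutativeSemigroup)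
open import Algebra.Properties.CommutativeSemigroup +-commutativeSemigroup using (x∙yz≈y∙xz)
open import Data.Fin using (Fin; zero; suc; punchIn; pinch; fromℕ<; splitAt; remQuot; _↑ˡ_)
open import Data.Fin.Properties using (_≟_; any?; punchInᵢ≢i; nonZeroIndex; splitAt-↑ˡ)
open import Data.Bool using (true; false; not)
open import Data.List using (List; []; _∷_; length; map)
open import Data.List.Properties using (length-map)
open import Data.List.Membership.Propositional using (_∈_; _∉_)
open import Data.List.Membership.Propositional.Properties using (∈-map⁺)
open import Data.List.Relation.Unary.Any using (here; there)
open import Data.Vec.Functional using (updateAt; insertAt)
open import Data.Vec.Functional.Properties
  using (updateAt-updates; updateAt-minimal; insertAt-lookup)
open import Data.Product using (∃; _×_; _,_; proj₁)
open import Data.Sum using (_⊎_; inj₁; inj₂)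
open import Function using (_∘_; const)
open import Relation.Nullary using (¬_; yes; no; ¬?; contradiction)
open import Relation.Nullary.Decidable using (dec-true; dec-false; _×-dec_)
open import Relation.Binary.PropositionalEquality
open import Relation.Binary.Construct.Closure.ReflexiveTransitive using (ε; _◅_)

pinch-punchIn : ∀ {n} (i j : Fin (suc n)) → pinch i (punchIn (suc i) j) ≡ j
pinch-punchIn         i       zero    = refl
pinch-punchIn         zero    (suc j) = refl
pinch-punchIn {suc n} (suc i) (suc j) = cong suc (pinch-punchIn i j)

squeeze : ∀ {n} → Fin (suc (suc n)) → Fin (suc (suc n)) → Fin (suc n)
squeeze zero    = pinch zero
squeeze (suc i) = pinch i

squeeze-punchIn : ∀ {n} (i : Fin (suc (suc n))) j → squeeze i (punchIn i j) ≡ j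
squeeze-punchIn zero    j = refl
squeeze-punchIn (suc i) j = pinch-punchIn i j

fresh : ∀ {n} (xs : List (Fin n)) → length xs < n → ∃ λ k → k ∉ xs
fresh {suc n}       []       _        = zero , λ ()
fresh {suc (suc n)} (x ∷ xs) (s≤s lt)
  with fresh (map (squeeze x) xs) (subst (_< suc n) (sym (length-map (squeeze x) xs)) lt)
... | k , k∉ = punchIn x k , λ where
  (here eq)  → punchInᵢ≢i x k eq
  (there k∈) → k∉ (subst (_∈ map (squeeze x) xs) (squeeze-punchIn x k)
                          (∈-map⁺ (squeeze x) k∈))

fresh₃ : ∀ {n} (i j l : Fin n) → 3 < n → ∃ λ k → k ≢ i × k ≢ j × k ≢ l
fresh₃ i j l 3<n with fresh (i ∷ j ∷ l ∷ []) 3<n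
... | k , k∉ = k , k∉ ∘ here , k∉ ∘ there ∘ here , k∉ ∘ there ∘ there ∘ here

ones : ∀ {N} → Config N
ones _ = 1

_[_]≔_ : ∀ {N} → Config N → Fin N → ℕ → Config N
φ [ x ]≔ c = updateAt φ x (const c)

configSize-mono : ∀ {N} {φ ψ : Config N} →
                  (∀ v → φ v ≤ ψ v) → configSize φ ≤ configSize ψ
configSize-mono {zero}  _   = z≤n
configSize-mono {suc N} φ≤ψ = +-mono-≤ (φ≤ψ zero) (configSize-mono (φ≤ψ ∘ suc))

configSize-ones : ∀ N → configSize (ones {N}) ≡ N
configSize-ones zero    = refl
configSize-ones (suc N) = cong suc (configSize-ones N)

configSize-[]≔ : ∀ {N} (φ : Config N) x c → φ x + configSize (φ [ x ]≔ c) ≡ c + configSize φ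
configSize-[]≔ {suc N} φ zero    c = x∙yz≈y∙xz (φ zero) c _
configSize-[]≔ {suc N} φ (suc x) c = begin
  φ (suc x) + (φ zero + tail′) ≡⟨ x∙yz≈y∙xz (φ (suc x)) (φ zero) tail′ ⟩
  φ zero + (φ (suc x) + tail′) ≡⟨ cong (φ zero +_) (configSize-[]≔ (φ ∘ suc) x c) ⟩
  φ zero + (c + tail)          ≡⟨ x∙yz≈y∙xz (φ zero) c tail ⟩
  c + (φ zero + tail)          ∎
  where
  open ≡-Reasoning
  tail  = configSize (φ ∘ suc)
  tail′ = configSize ((φ ∘ suc) [ x ]≔ c)

configSize-[]≔-one : ∀ {N} (φ : Config N) x c → φ x ≡ 1 →
                     suc (configSize (φ [ x ]≔ c)) ≡ c + configSize φ
configSize-[]≔-one φ x c φx≡1 =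
  subst (λ k → k + configSize (φ [ x ]≔ c) ≡ c + configSize φ) φx≡1 (configSize-[]≔ φ x c)

≤-[]≔ : ∀ {N m} {β : Config N} {x c} u →
        (u ≡ x → m ≤ c) → (u ≢ x → m ≤ β u) → m ≤ (β [ x ]≔ c) u
≤-[]≔ {m = m} {β} {x} u at elsewhere with u ≟ x
... | yes refl = subst (m ≤_) (sym (updateAt-updates u β)) (at refl)
... | no u≢x   = subst (m ≤_) (sym (updateAt-minimal u x β u≢x)) (elsewhere u≢x)

sparse⇒configSize< : ∀ {N} {φ : Config N} r → (∀ u → φ u ≤ 1) → φ r ≡ 0 → configSize φ < N
sparse⇒configSize< {N} {φ} r φ≤1 φr≡0 =
  subst (configSize φ <_) configSize-β (s≤s (configSize-mono φ≤β))
  where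
  β = ones [ r ]≔ 0
  configSize-β : suc (configSize β) ≡ N
  configSize-β = trans (configSize-[]≔-one ones r 0 refl) (configSize-ones N)
  φ≤β : ∀ u → φ u ≤ β u
  φ≤β u = ≤-[]≔ u (λ { refl → ≤-reflexive φr≡0 }) (λ _ → φ≤1 u)

-- Three empty vertices pay for the two surplus pebbles on v.
nearlySparse⇒configSize< :
  ∀ {N} {φ : Config N} {r z₁ z₂ v} →
  z₁ ≢ r → z₂ ≢ r → z₂ ≢ z₁ → v ≢ r → v ≢ z₁ → v ≢ z₂ →
  φ r ≡ 0 → φ z₁ ≡ 0 → φ z₂ ≡ 0 → φ v ≤ 3 → (∀ u → u ≢ v → φ u ≤ 1) →
  configSize φ < N
nearlySparse⇒configSize< {N} {φ} {r} {z₁} {z₂} {v}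
  z₁≢r z₂≢r z₂≢z₁ v≢r v≢z₁ v≢z₂ φr≡0 φz₁≡0 φz₂≡0 φv≤3 φ≤1 =
  subst (configSize φ <_) configSize-β (s≤s (configSize-mono φ≤β₄))
  where
  β₁ = ones [ r ]≔ 0
  β₂ = β₁ [ z₁ ]≔ 0
  β₃ = β₂ [ z₂ ]≔ 0
  β₄ = β₃ [ v ]≔ 3
  β₁z₁≡1 : β₁ z₁ ≡ 1
  β₁z₁≡1 = updateAt-minimal z₁ r ones z₁≢r
  β₂z₂≡1 : β₂ z₂ ≡ 1
  β₂z₂≡1 = trans (updateAt-minimal z₂ z₁ β₁ z₂≢z₁) (updateAt-minimal z₂ r ones z₂≢r)
  β₃v≡1 : β₃ v ≡ 1
  β₃v≡1 = trans (updateAt-minimal v z₂ β₂ v≢z₂)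
            (trans (updateAt-minimal v z₁ β₁ v≢z₁) (updateAt-minimal v r ones v≢r))
  configSize-β : suc (configSize β₄) ≡ N
  configSize-β = begin
    suc (configSize β₄)   ≡⟨ configSize-[]≔-one β₃ v 3 β₃v≡1 ⟩
    3 + configSize β₃     ≡⟨ cong (2 +_) (configSize-[]≔-one β₂ z₂ 0 β₂z₂≡1) ⟩
    2 + configSize β₂     ≡⟨ cong (1 +_) (configSize-[]≔-one β₁ z₁ 0 β₁z₁≡1) ⟩
    1 + configSize β₁     ≡⟨ configSize-[]≔-one ones r 0 refl ⟩
    configSize (ones {N}) ≡⟨ configSize-ones N ⟩
    N                     ∎
    where open ≡-Reasoning
  φ≤β₄ : ∀ u → φ u ≤ β₄ u
  φ≤β₄ u = ≤-[]≔ u (λ { refl → φv≤3 }) λ u≢v →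
           ≤-[]≔ u (λ { refl → ≤-reflexive φz₂≡0 }) λ _ →
           ≤-[]≔ u (λ { refl → ≤-reflexive φz₁≡0 }) λ _ →
           ≤-[]≔ u (λ { refl → ≤-reflexive φr≡0 }) λ _ →
           φ≤1 u u≢v

configSize-insertAt : ∀ {N} (φ : Config N) i c →
                      configSize (insertAt φ i c) ≡ c + configSize φ
configSize-insertAt         φ zero    c = refl
configSize-insertAt {suc N} φ (suc i) c =
  trans (cong (φ zero +_) (configSize-insertAt (φ ∘ suc) i c)) (x∙yz≈y∙xz (φ zero) c _)

insertAt-≤ : ∀ {N b} {φ : Config N} {c} →
             (∀ j → φ j ≤ b) → c ≤ b → ∀ i u → insertAt φ i c u ≤ b
insertAt-≤         φ≤b c≤b zero    zero    = c≤b
insertAt-≤         φ≤b c≤b zero    (suc j) = φ≤b j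
insertAt-≤ {suc N} φ≤b c≤b (suc i) zero    = φ≤b zero
insertAt-≤ {suc N} φ≤b c≤b (suc i) (suc j) = insertAt-≤ (φ≤b ∘ suc) c≤b i j

firstOnes : ∀ {N} → ℕ → Config N
firstOnes zero    _       = 0
firstOnes (suc k) zero    = 1
firstOnes (suc k) (suc i) = firstOnes k i

firstOnes-≤1 : ∀ {N} k (i : Fin N) → firstOnes k i ≤ 1
firstOnes-≤1 zero    _       = z≤n
firstOnes-≤1 (suc k) zero    = s≤s z≤n
firstOnes-≤1 (suc k) (suc i) = firstOnes-≤1 k i

configSize-firstOnes : ∀ {N} k → k ≤ N → configSize (firstOnes {N} k) ≡ k
configSize-firstOnes {zero}  zero    _         = refl
configSize-firstOnes {suc N} zero    _         = configSize-firstOnes {N} zero z≤n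
configSize-firstOnes {suc N} (suc k) (s≤s k≤N) = cong suc (configSize-firstOnes k k≤N)

unsolvable-sparse : ∀ {N} {a : Adjacency N} {r φ} →
                    (∀ u → φ u ≤ 1) → φ r ≡ 0 → ¬ Solvable a r φ
unsolvable-sparse φ≤1 φr≡0 (_ , ε , occupied) =
  contradiction (subst (1 ≤_) φr≡0 occupied) λ ()
unsolvable-sparse φ≤1 φr≡0 (_ , step _ u _ _ rich ◅ _ , _) =
  contradiction (≤-trans rich (φ≤1 u)) λ { (s≤s ()) }

¬allSolvable-below : ∀ {N} {a : Adjacency N} r k → k < N → ¬ AllSolvable a r k
¬allSolvable-below {suc N} r k (s≤s k≤N) allSolvable =
  unsolvable-sparse (insertAt-≤ (firstOnes-≤1 k) z≤n r) (insertAt-lookup (firstOnes k) r 0)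
    (allSolvable φ (trans (configSize-insertAt (firstOnes k) r 0) (configSize-firstOnes k k≤N)))
  where φ = insertAt (firstOnes k) r 0

allSolvable⇒isRootedPebblingNumber : ∀ {N} {a : Adjacency N} r →
                                     AllSolvable a r N → IsRootedPebblingNumber a r N
allSolvable⇒isRootedPebblingNumber {N} r solvable =
  >-nonZero⁻¹ N {{nonZeroIndex r}} , solvable , λ k _ → ¬allSolvable-below r k

allSolvable⇒Class0 : ∀ {N} {a : Adjacency N} → Fin N → (∀ r → AllSolvable a r N) → Class0 a
allSolvable⇒Class0 r₀ solvable =
  (λ r → _ , allSolvable⇒isRootedPebblingNumber r (solvable r) , ≤-refl) ,
  r₀ , allSolvable⇒isRootedPebblingNumber r₀ (solvable r₀)

move-source : ∀ {N} (φ : Config N) u v → move φ u v u ≡ φ u ∸ 2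
move-source φ u v rewrite dec-true (u ≟ u) refl = refl

move-target : ∀ {N} (φ : Config N) {u v} → v ≢ u → move φ u v v ≡ suc (φ v)
move-target φ {u} {v} v≢u rewrite dec-false (v ≟ u) v≢u | dec-true (v ≟ v) refl = refl

move-other : ∀ {N} (φ : Config N) {u v w} → w ≢ u → w ≢ v → move φ u v w ≡ φ w
move-other φ {u} {v} {w} w≢u w≢v rewrite dec-false (w ≟ u) w≢u | dec-false (w ≟ v) w≢v = refl

module Solvability {N} (a : Adjacency N) (irreflexive : ∀ x → a x x ≡ false) where

  adj⇒≢ : ∀ {x y} → a x y ≡ true → x ≢ y
  adj⇒≢ {x} axy refl = contradiction (trans (sym (irreflexive x)) axy) λ ()

  move-fills-target : ∀ φ {u v} → a u v ≡ true → 1 ≤ move φ u v v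
  move-fills-target φ auv = subst (1 ≤_) (sym (move-target φ (≢-sym (adj⇒≢ auv)))) (s≤s z≤n)

  solvable-here : ∀ {r φ} → 1 ≤ φ r → Solvable a r φ
  solvable-here occupied = _ , ε , occupied

  solvable-after : ∀ {r φ u v} → a u v ≡ true → 2 ≤ φ u →
                   Solvable a r (move φ u v) → Solvable a r φ
  solvable-after {φ = φ} {u} {v} auv rich (ψ , reach , occupied) =
    ψ , step φ u v auv rich ◅ reach , occupied

  solvable-adjacent : ∀ {r φ u} → a u r ≡ true → 2 ≤ φ u → Solvable a r φ
  solvable-adjacent {φ = φ} aur rich =
    solvable-after aur rich (solvable-here (move-fills-target φ aur))

  relay-occupied : ∀ {r φ v z} → a v z ≡ true → a z r ≡ true →
                   2 ≤ φ v → 1 ≤ φ z → Solvable a r φ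
  relay-occupied {φ = φ} avz azr rich occupied =
    solvable-after avz rich
      (solvable-adjacent azr
        (subst (2 ≤_) (sym (move-target φ (≢-sym (adj⇒≢ avz)))) (s≤s occupied)))

  relay-double : ∀ {r φ v z} → a v z ≡ true → a z r ≡ true → 4 ≤ φ v → Solvable a r φ
  relay-double {φ = φ} {v} {z} avz azr 4≤φv =
    solvable-after avz (≤-trans (s≤s (s≤s z≤n)) 4≤φv)
      (relay-occupied avz azr
        (subst (2 ≤_) (sym (move-source φ v z)) (∸-monoˡ-≤ 2 4≤φv))
        (move-fills-target φ avz))

  relay-pair : ∀ {r φ v w z} → a v z ≡ true → a w z ≡ true → a z r ≡ true → w ≢ v →
               2 ≤ φ v → 2 ≤ φ w → Solvable a r φ
  relay-pair {φ = φ} avz awz azr w≢v richv richw =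
    solvable-after avz richv
      (relay-occupied awz azr
        (subst (2 ≤_) (sym (move-other φ w≢v (adj⇒≢ awz))) richw)
        (move-fills-target φ avz))

record HubPartition {N} (a : Adjacency N) (n : ℕ) : Set where
  field
    part     : Fin N → Fin n
    hub      : Fin n → Fin N
    part-hub : ∀ k → part (hub k) ≡ k
    hub-adj  : ∀ k x → k ≢ part x → a (hub k) x ≡ true
    adj-hub  : ∀ k x → k ≢ part x → a x (hub k) ≡ true

module _ {N n} {a : Adjacency N} (irreflexive : ∀ x → a x x ≡ false)
         (H : HubPartition a n) (3<n : 3 < n) where
  open HubPartition H
  open Solvability a irreflexive

  solvable-two-rich : ∀ {r φ v w} → w ≢ v → 2 ≤ φ v → 2 ≤ φ w → Solvable a r φ
  solvable-two-rich {r} {φ} {v} {w} w≢v richv richw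
    with fresh₃ (part r) (part v) (part w) 3<n
  ... | k , k≢r , k≢v , k≢w =
    relay-pair (adj-hub k v k≢v) (adj-hub k w k≢w) (hub-adj k r k≢r) w≢v richv richw

  solvable-one-rich : ∀ {r φ v} → configSize φ ≡ N → φ r ≡ 0 →
                      2 ≤ φ v → (∀ u → u ≢ v → φ u ≤ 1) → Solvable a r φ
  solvable-one-rich {r} {φ} {v} size φr≡0 rich others
    with fresh₃ (part r) (part v) (part r) 3<n
  ... | k₁ , k₁≢r , k₁≢v , _
    with fresh₃ (part r) (part v) k₁ 3<n
  ... | k₂ , k₂≢r , k₂≢v , k₂≢k₁
    with 1 ≤? φ (hub k₁) | 1 ≤? φ (hub k₂) | 4 ≤? φ v
  ... | yes occupied | _            | _        =
    relay-occupied (adj-hub k₁ v k₁≢v) (hub-adj k₁ r k₁≢r) rich occupied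
  ... | _            | yes occupied | _        =
    relay-occupied (adj-hub k₂ v k₂≢v) (hub-adj k₂ r k₂≢r) rich occupied
  ... | _            | _            | yes 4≤φv =
    relay-double (adj-hub k₁ v k₁≢v) (hub-adj k₁ r k₁≢r) 4≤φv
  ... | no empty₁    | no empty₂    | no φv≱4  =
    contradiction size (<⇒≢ (nearlySparse⇒configSize<
      (adj⇒≢ (hub-adj k₁ r k₁≢r)) (adj⇒≢ (hub-adj k₂ r k₂≢r))
      (adj⇒≢ (hub-adj k₂ (hub k₁) (λ e → k₂≢k₁ (trans e (part-hub k₁)))))
      (λ { refl → contradiction (subst (2 ≤_) φr≡0 rich) λ () })
      (adj⇒≢ (adj-hub k₁ v k₁≢v)) (adj⇒≢ (adj-hub k₂ v k₂≢v))
      φr≡0 (n≤0⇒n≡0 (≮⇒≥ empty₁)) (n≤0⇒n≡0 (≮⇒≥ empty₂)) (≮⇒≥ φv≱4) others))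

  solvable-of-size : ∀ r φ → configSize φ ≡ N → Solvable a r φ
  solvable-of-size r φ size with 1 ≤? φ r
  ... | yes occupied = solvable-here occupied
  ... | no empty
    with any? (λ v → 2 ≤? φ v)
  ... | no noneRich =
    contradiction size
      (<⇒≢ (sparse⇒configSize< r (λ u → ≮⇒≥ (noneRich ∘ (u ,_))) (n≤0⇒n≡0 (≮⇒≥ empty))))
  ... | yes (v , rich)
    with any? (λ w → ¬? (w ≟ v) ×-dec 2 ≤? φ w)
  ... | yes (w , w≢v , richw) = solvable-two-rich w≢v rich richw
  ... | no noOtherRich =
    solvable-one-rich size (n≤0⇒n≡0 (≮⇒≥ empty)) rich
      (λ u u≢v → ≮⇒≥ (λ richu → noOtherRich (u , u≢v , richu)))

  hubPartition⇒Class0 : Class0 a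
  hubPartition⇒Class0 = allSolvable⇒Class0 (hub (fromℕ< 3<n)) solvable-of-size

module _ (n : ℕ) (G : SimpleGraph) where
  private
    m = size G

    index : Fin n ⊎ Fin (n * m) → Fin n
    index (inj₁ i) = i
    index (inj₂ k) = proj₁ (remQuot {n} m k)

  knStar-irreflexive : ∀ x → KnStar n G x x ≡ false
  knStar-irreflexive x with splitAt n x
  ... | inj₁ i = cong not (dec-true (i ≟ i) refl)
  ... | inj₂ l rewrite dec-true (index (inj₂ l) ≟ index (inj₂ l)) refl = irrefl G _

  knStar-hubPartition : HubPartition (KnStar n G) n
  knStar-hubPartition = record
    { part     = index ∘ splitAt n
    ; hub      = _↑ˡ n * m
    ; part-hub = λ k → cong index (splitAt-↑ˡ n k (n * m))
    ; hub-adj  = hub-adj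
    ; adj-hub  = adj-hub
    }
    where
    hub-adj : ∀ k x → k ≢ index (splitAt n x) → KnStar n G (k ↑ˡ n * m) x ≡ true
    hub-adj k x k≢ with splitAt n (k ↑ˡ n * m) | splitAt-↑ˡ n k (n * m) | splitAt n x
    ... | .(inj₁ k) | refl | inj₁ i = cong not (dec-false (k ≟ i) k≢)
    ... | .(inj₁ k) | refl | inj₂ l = cong not (dec-false (k ≟ _) k≢)
    adj-hub : ∀ k x → k ≢ index (splitAt n x) → KnStar n G x (k ↑ˡ n * m) ≡ true
    adj-hub k x k≢ with splitAt n x | splitAt n (k ↑ˡ n * m) | splitAt-↑ˡ n k (n * m)
    ... | inj₁ i | .(inj₁ k) | refl = cong not (dec-false (i ≟ k) (≢-sym k≢))
    ... | inj₂ l | .(inj₁ k) | refl = cong not (dec-false (k ≟ _) k≢)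

mainTheorem9 : (n : ℕ) → 4 ≤ n → (G : SimpleGraph) → Class0 (KnStar n G)
mainTheorem9 n 4≤n G = hubPartition⇒Class0 (knStar-irreflexive n G) (knStar-hubPartition n G) 4≤n
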